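{- Let $a,b,p,q\in\mathbb{Z}$ and let $(W_n)_{n\ge0}$ be defined by $W_0=a$, $W_1=b$, $W_n=pW_{n-1}+qW_{n-2}$ for $n\ge2$; let $(V_n)_{n\ge0}$ be defined by $V_0=2$, $V_1=p$, $V_n=pV_{n-1}+qV_{n-2}$ for $n\ge2$. Let $i$ be a positive integer and $n\ge2$ an integer. If $i$ is odd, then \[ W_{ni+i}=\sum_{j=0}^{\lfloor n/2\rfloor}\binom{n-j}{j}V_i^{\,n-2j}q^{ij}W_i+q^{i}a\sum_{j=0}^{\lfloor (n-1)/2\rfloor}\binom{n-j-1}{j}V_i^{\,n-2j-1}q^{ij}, \] and if $i$ is even, then \[ W_{ni+i}=\sum_{j=0}^{\lfloor n/2\rfloor}\binom{n-j}{j}(-1)^jV_i^{\,n-2j}q^{ij}W_i-q^{i}a\sum_{j=0}^{\lfloor (n-1)/2\rfloor}\binom{n-j-1}{j}(-1)^jV_i^{\,n-2j-1}q^{ij}. \]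
   Context: $W_n$ is the Horadam sequence $W_n(a,b;p,q)$ and $V_n$ the generalized Lucas sequence $W_n(2,p;p,q)$. -}

module Defs where

open import Data.Nat using (ℕ; zero; suc) renaming (_+_ to _+ℕ_; _*_ to _*ℕ_)
open import Data.Integer using (ℤ; +_; _+_; _*_)
open import Data.Product using (∃)
open import Relation.Binary.PropositionalEquality using (_≡_)

W : ℤ → ℤ → ℤ → ℤ → ℕ → ℤ
W a b p q zero = a
W a b p q (suc zero) = b
W a b p q (suc (suc n)) = p * W a b p q (suc n) + q * W a b p q n

V : ℤ → ℤ → ℕ → ℤ
V p q = W (+ 2) p p q

sumTo : ℕ → (ℕ → ℤ) → ℤ
sumTo zero f = f zero
sumTo (suc m) f = sumTo m f + f (suc m)

Odd : ℕ → Set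
Odd i = ∃ λ k → i ≡ suc (2 *ℕ k)

Even : ℕ → Set
Even i = ∃ λ k → i ≡ 2 *ℕ k

-- Fixing i, the subsequence U k = W (k i) satisfies the second-order recurrence
-- U (k + 2) = V i U (k + 1) − (−q)^i U k, which follows from the multisection
-- identity W (m + 2i) + (−q)^i W m = V i W (m + i) by induction on i.  Every solution
-- of U (k + 2) = x U (k + 1) + y U k is U (n + 2) = F (n + 1) U 1 + y F n U 0, where
-- F m = Σ_j C(m − j, j) x^(m − 2j) y^j are the Fibonacci polynomials (they satisfy the
-- same recurrence by Pascal's rule).  With x = V i and y = −(−q)^i = ±q^i according to
-- the parity of i, this is the theorem.
module Submission where

open import Defs
open import Data.Nat using (ℕ; zero; suc; _≤_; _<_; _≤′_; ≤′-refl; ≤′-step; s≤s; z≤n; _∸_; _/_)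
  renaming (_*_ to _*ℕ_; _+_ to _+ℕ_)
open import Data.Nat.Properties
  using (≤-trans; ≤-reflexive; ≤-pred; <⇒≤; <⇒≱; ≰⇒>; <-≤-trans; _≤?_; ≤⇒≤′; ≤′⇒≤;
         +-comm; +-suc; +-identityʳ; *-comm; *-suc; m∸n≤m; ∸-monoˡ-≤; m+n∸m≡n; ∸-+-assoc;
         +-∸-assoc; pred[m∸n]≡m∸[1+n]; m∸n≡0⇒m≤n; m<n+o⇒m∸n<o)
open import Data.Nat.DivMod using (m*n/n≡m; /-monoˡ-≤; m/n<m; m/n≤m)
open import Data.Nat.Combinatorics using (_C_; k>n⇒nCk≡0; nCk+nC[k+1]≡[n+1]C[k+1])
open import Data.Integer using (ℤ; +_; -_; _+_; _-_; _*_; _^_)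
open import Data.Integer.Properties
  using (pos-+; +-assoc; *-assoc; *-zeroʳ; *-identityˡ; *-distribʳ-+; ^-*-assoc; ^-zeroˡ;
         -1*i≡-i; neg-involutive)
  renaming (+-identityʳ to +ℤ-identityʳ)
open import Data.Integer.Tactic.RingSolver using (solve-∀)
open import Data.Product using (_×_; _,_; proj₁)
open import Function using (_∘_)
open import Relation.Binary.PropositionalEquality
  using (_≡_; refl; sym; trans; cong; cong₂; subst; module ≡-Reasoning)
open import Relation.Nullary using (yes; no)
open ≡-Reasoning

ℕ-induction₂ : ∀ {ℓ} (P : ℕ → Set ℓ) → P 0 → P 1 →
               (∀ n → P n → P (suc n) → P (suc (suc n))) → ∀ n → P n
ℕ-induction₂ P P0 P1 step n = proj₁ (pair n)
  where
  pair : ∀ n → P n × P (suc n)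
  pair zero = P0 , P1
  pair (suc n) with pair n
  ... | Pn , Pn+1 = Pn+1 , step n Pn Pn+1

sumTo-cong : ∀ K {f g : ℕ → ℤ} → (∀ j → f j ≡ g j) → sumTo K f ≡ sumTo K g
sumTo-cong zero    f≡g = f≡g zero
sumTo-cong (suc K) f≡g = cong₂ _+_ (sumTo-cong K f≡g) (f≡g (suc K))

sumTo-suc : ∀ K (f : ℕ → ℤ) → sumTo (suc K) f ≡ f 0 + sumTo K (f ∘ suc)
sumTo-suc zero    f = refl
sumTo-suc (suc K) f = trans (cong (_+ f (suc (suc K))) (sumTo-suc K f))
                            (+-assoc (f 0) (sumTo K (f ∘ suc)) (f (suc (suc K))))

sumTo-linear : ∀ K (x y : ℤ) {f g h : ℕ → ℤ} → (∀ j → f j ≡ x * g j + y * h j) →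
               sumTo K f ≡ x * sumTo K g + y * sumTo K h
sumTo-linear zero    x y f≡ = f≡ zero
sumTo-linear (suc K) x y {f} {g} {h} f≡ =
  trans (cong₂ _+_ (sumTo-linear K x y f≡) (f≡ (suc K)))
        (regroup x y (sumTo K g) (sumTo K h) (g (suc K)) (h (suc K)))
  where
  regroup : ∀ x y G H g h → (x * G + y * H) + (x * g + y * h) ≡ x * (G + g) + y * (H + h)
  regroup = solve-∀

sumTo-*ʳ : ∀ K (f : ℕ → ℤ) c → sumTo K (λ j → f j * c) ≡ sumTo K f * c
sumTo-*ʳ zero    f c = refl
sumTo-*ʳ (suc K) f c = trans (cong (_+ f (suc K) * c) (sumTo-*ʳ K f c))
                             (sym (*-distribʳ-+ c (sumTo K f) (f (suc K))))

[1+m]∸n∸1≡m∸n : ∀ m n → suc m ∸ n ∸ 1 ≡ m ∸ n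
[1+m]∸n∸1≡m∸n m n = trans (∸-+-assoc (suc m) n 1) (cong (suc m ∸_) (+-comm n 1))

m≤2n⇒m∸n≤n : ∀ m n → m ≤ 2 *ℕ n → m ∸ n ≤ n
m≤2n⇒m∸n≤n m n m≤2n = ≤-trans (∸-monoˡ-≤ n m≤2n)
                                 (≤-reflexive (trans (m+n∸m≡n n (n +ℕ 0)) (+-identityʳ n)))

m/2<n⇒m∸n<n : ∀ m n → m / 2 < n → m ∸ n < n
m/2<n⇒m∸n<n m (suc n) m/2<n =
  m<n+o⇒m∸n<o m (suc n) (subst (m <_) (cong (suc n +ℕ_) (+-identityʳ (suc n))) m<2n)
  where
  m<2n : m < 2 *ℕ suc n
  m<2n = ≰⇒> λ 2n≤m → <⇒≱ m/2<n (subst (_≤ m / 2) (m*n/n≡m (suc n) 2)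
                                        (/-monoˡ-≤ 2 (subst (_≤ m) (*-comm 2 (suc n)) 2n≤m)))

[1+m∸j]C[1+j]≡[m∸j]Cj+[m∸j]C[1+j] : ∀ m j → (suc m ∸ j) C suc j ≡ (m ∸ j) C j +ℕ (m ∸ j) C suc j
[1+m∸j]C[1+j]≡[m∸j]Cj+[m∸j]C[1+j] m j with j ≤? m
... | yes j≤m = trans (cong (_C suc j) (+-∸-assoc 1 j≤m))
                      (sym (nCk+nC[k+1]≡[n+1]C[k+1] (m ∸ j) j))
... | no  j≰m = trans (k>n⇒nCk≡0 (s≤s (≤-trans (m∸n≤m (suc m) j) m<j)))
                      (sym (cong₂ _+ℕ_ (k>n⇒nCk≡0 (<-≤-trans (s≤s (m∸n≤m m j)) m<j))
                                       (k>n⇒nCk≡0 (s≤s (≤-trans (m∸n≤m m j) (<⇒≤ m<j))))))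
  where
  m<j : m < j
  m<j = ≰⇒> j≰m

module FibonacciPolynomial (x y : ℤ) where

  term : ℕ → ℕ → ℤ
  term m j = + ((m ∸ j) C j) * x ^ (m ∸ 2 *ℕ j) * y ^ j

  F : ℕ → ℤ
  F m = sumTo (m / 2) (term m)

  term-vanishes : ∀ m j → m / 2 < j → term m j ≡ + 0
  term-vanishes m j m/2<j rewrite k>n⇒nCk≡0 (m/2<n⇒m∸n<n m j m/2<j) = refl

  sumTo-term≡F : ∀ m K → m / 2 ≤ K → sumTo K (term m) ≡ F m
  sumTo-term≡F m K m/2≤K = go (≤⇒≤′ m/2≤K)
    where
    go : ∀ {K} → m / 2 ≤′ K → sumTo K (term m) ≡ F m
    go ≤′-refl = refl
    go (≤′-step {K} m/2≤K) =
      trans (cong₂ _+_ (go m/2≤K) (term-vanishes m (suc K) (s≤s (≤′⇒≤ m/2≤K))))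
            (+ℤ-identityʳ (F m))

  term-head : ∀ m → term (suc m) 0 ≡ x * term m 0
  term-head m = lemma x (x ^ m)
    where
    lemma : ∀ x X → + 1 * (x * X) * + 1 ≡ x * (+ 1 * X * + 1)
    lemma = solve-∀

  -- When m ≤ 2j the power x ^ (m ∸ 2j) is x ^ 0, but then the coefficient vanishes.
  coeff*x^d≡x*coeff*x^[d-1] : ∀ m j →
    + ((m ∸ j) C suc j) * x ^ (m ∸ 2 *ℕ j) ≡ x * (+ ((m ∸ j) C suc j) * x ^ (m ∸ suc (2 *ℕ j)))
  coeff*x^d≡x*coeff*x^[d-1] m j rewrite sym (pred[m∸n]≡m∸[1+n] m (2 *ℕ j)) with m ∸ 2 *ℕ j in eq
  ... | zero   rewrite k>n⇒nCk≡0 (s≤s (m≤2n⇒m∸n≤n m j (m∸n≡0⇒m≤n eq))) = sym (*-zeroʳ x)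
  ... | suc d  = lemma (+ ((m ∸ j) C suc j)) x (x ^ d)
    where
    lemma : ∀ c x X → c * (x * X) ≡ x * (c * X)
    lemma = solve-∀

  term-recurrence : ∀ m j → term (suc (suc m)) (suc j) ≡ x * term (suc m) (suc j) + y * term m j
  term-recurrence m j = begin
      + c₀ * x ^ (suc (suc m) ∸ 2 *ℕ suc j) * (y * y ^ j)
    ≡⟨ cong (λ k → + c₀ * x ^ (suc (suc m) ∸ k) * (y * y ^ j)) (*-suc 2 j) ⟩
      + c₀ * x ^ d * (y * y ^ j)
    ≡⟨ cong (λ c → c * x ^ d * (y * y ^ j))
            (trans (cong +_ ([1+m∸j]C[1+j]≡[m∸j]Cj+[m∸j]C[1+j] m j)) (pos-+ c₂ c₁)) ⟩
      (+ c₂ + + c₁) * x ^ d * (y * y ^ j)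
    ≡⟨ distrib y (+ c₂) (+ c₁) (x ^ d) (y ^ j) ⟩
      + c₁ * x ^ d * (y * y ^ j) + y * (+ c₂ * x ^ d * y ^ j)
    ≡⟨ cong (λ t → t * (y * y ^ j) + y * term m j) (coeff*x^d≡x*coeff*x^[d-1] m j) ⟩
      x * (+ c₁ * x ^ (m ∸ suc (2 *ℕ j))) * (y * y ^ j) + y * term m j
    ≡⟨ cong (_+ y * term m j) (*-assoc x (+ c₁ * x ^ (m ∸ suc (2 *ℕ j))) (y * y ^ j)) ⟩
      x * (+ c₁ * x ^ (m ∸ suc (2 *ℕ j)) * (y * y ^ j)) + y * term m j
    ≡⟨ cong (λ k → x * (+ c₁ * x ^ (suc m ∸ k) * (y * y ^ j)) + y * term m j) (sym (*-suc 2 j)) ⟩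
      x * term (suc m) (suc j) + y * term m j
    ∎
    where
    c₀ = (suc m ∸ j) C suc j
    c₁ = (m ∸ j) C suc j
    c₂ = (m ∸ j) C j
    d  = m ∸ 2 *ℕ j
    distrib : ∀ y C₂ C₁ X Y → (C₂ + C₁) * X * (y * Y) ≡ C₁ * X * (y * Y) + y * (C₂ * X * Y)
    distrib = solve-∀

  sumTo-term-recurrence : ∀ m K →
    sumTo (suc K) (term (suc (suc m))) ≡ x * sumTo (suc K) (term (suc m)) + y * sumTo K (term m)
  sumTo-term-recurrence m K = begin
      sumTo (suc K) (term (suc (suc m)))
    ≡⟨ sumTo-suc K (term (suc (suc m))) ⟩
      term (suc (suc m)) 0 + sumTo K (term (suc (suc m)) ∘ suc)
    ≡⟨ cong₂ _+_ (term-head (suc m)) (sumTo-linear K x y (term-recurrence m)) ⟩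
      x * term (suc m) 0 + (x * sumTo K (term (suc m) ∘ suc) + y * sumTo K (term m))
    ≡⟨ regroup x y (term (suc m) 0) (sumTo K (term (suc m) ∘ suc)) (sumTo K (term m)) ⟩
      x * (term (suc m) 0 + sumTo K (term (suc m) ∘ suc)) + y * sumTo K (term m)
    ≡⟨ cong (λ s → x * s + y * sumTo K (term m)) (sym (sumTo-suc K (term (suc m)))) ⟩
      x * sumTo (suc K) (term (suc m)) + y * sumTo K (term m)
    ∎
    where
    regroup : ∀ x y A B C → x * A + (x * B + y * C) ≡ x * (A + B) + y * C
    regroup = solve-∀

  F-recurrence : ∀ m → F (suc (suc m)) ≡ x * F (suc m) + y * F m
  F-recurrence m = begin
      F (suc (suc m))
    ≡⟨ sym (sumTo-term≡F (suc (suc m)) (suc m)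
                         (≤-pred (m/n<m (suc (suc m)) 2 (s≤s (s≤s z≤n))))) ⟩
      sumTo (suc m) (term (suc (suc m)))
    ≡⟨ sumTo-term-recurrence m m ⟩
      x * sumTo (suc m) (term (suc m)) + y * sumTo m (term m)
    ≡⟨ cong₂ (λ s t → x * s + y * t) (sumTo-term≡F (suc m) (suc m) (m/n≤m (suc m) 2))
                                     (sumTo-term≡F m m (m/n≤m m 2)) ⟩
      x * F (suc m) + y * F m
    ∎

  recurrence-solution : (U : ℕ → ℤ) → (∀ k → U (suc (suc k)) ≡ x * U (suc k) + y * U k) →
                        ∀ n → U (suc (suc n)) ≡ F (suc n) * U 1 + y * U 0 * F n
  recurrence-solution U U-rec zero = trans (U-rec 0) (lemma x y (U 1) (U 0))
    where
    lemma : ∀ x y U₁ U₀ → x * U₁ + y * U₀ ≡ + 1 * (x * + 1) * + 1 * U₁ + y * U₀ * + 1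
    lemma = solve-∀
  recurrence-solution U U-rec (suc n) = begin
      U (suc (suc (suc n)))
    ≡⟨ recurrence-solution (U ∘ suc) (U-rec ∘ suc) n ⟩
      F (suc n) * U 2 + y * U 1 * F n
    ≡⟨ cong (λ u → F (suc n) * u + y * U 1 * F n) (U-rec 0) ⟩
      F (suc n) * (x * U 1 + y * U 0) + y * U 1 * F n
    ≡⟨ regroup x y (F (suc n)) (F n) (U 1) (U 0) ⟩
      (x * F (suc n) + y * F n) * U 1 + y * U 0 * F (suc n)
    ≡⟨ cong (λ f → f * U 1 + y * U 0 * F (suc n)) (sym (F-recurrence n)) ⟩
      F (suc (suc n)) * U 1 + y * U 0 * F (suc n)
    ∎
    where
    regroup : ∀ x y F₁ F₀ U₁ U₀ →
              F₁ * (x * U₁ + y * U₀) + y * U₁ * F₀ ≡ (x * F₁ + y * F₀) * U₁ + y * U₀ * F₁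
    regroup = solve-∀

  F≡sumTo-shifted : ∀ n →
    F n ≡ sumTo (n / 2) (λ j → + ((suc n ∸ j ∸ 1) C j) * x ^ (suc n ∸ 2 *ℕ j ∸ 1) * y ^ j)
  F≡sumTo-shifted n = sumTo-cong (n / 2) λ j →
    sym (cong₂ (λ c e → + (c C j) * x ^ e * y ^ j)
               ([1+m]∸n∸1≡m∸n n j) ([1+m]∸n∸1≡m∸n n (2 *ℕ j)))

[-x]^n≡[-1]^n*x^n : ∀ x n → (- x) ^ n ≡ (- + 1) ^ n * x ^ n
[-x]^n≡[-1]^n*x^n x zero    = refl
[-x]^n≡[-1]^n*x^n x (suc n) =
  trans (cong (- x *_) ([-x]^n≡[-1]^n*x^n x n)) (lemma x ((- + 1) ^ n) (x ^ n))
  where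
  lemma : ∀ x S X → - x * (S * X) ≡ (- + 1 * S) * (x * X)
  lemma = solve-∀

[-1]^[2k]≡1 : ∀ k → (- + 1) ^ (2 *ℕ k) ≡ + 1
[-1]^[2k]≡1 k = trans (sym (^-*-assoc (- + 1) 2 k)) (^-zeroˡ k)

Even⇒[-x]^n≡x^n : ∀ x {n} → Even n → (- x) ^ n ≡ x ^ n
Even⇒[-x]^n≡x^n x (k , refl) =
  trans ([-x]^n≡[-1]^n*x^n x (2 *ℕ k))
        (trans (cong (_* x ^ (2 *ℕ k)) ([-1]^[2k]≡1 k)) (*-identityˡ (x ^ (2 *ℕ k))))

Odd⇒[-x]^n≡-x^n : ∀ x {n} → Odd n → (- x) ^ n ≡ - (x ^ n)
Odd⇒[-x]^n≡-x^n x (k , refl) =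
  trans ([-x]^n≡[-1]^n*x^n x (suc (2 *ℕ k)))
        (trans (cong (λ s → - + 1 * s * x ^ suc (2 *ℕ k)) ([-1]^[2k]≡1 k))
               (-1*i≡-i (x ^ suc (2 *ℕ k))))

signed-summand : ∀ x y c e j → + c * x ^ e * (- y) ^ j ≡ + c * (- + 1) ^ j * x ^ e * y ^ j
signed-summand x y c e j =
  trans (cong (+ c * x ^ e *_) ([-x]^n≡[-1]^n*x^n y j)) (lemma (+ c) (x ^ e) ((- + 1) ^ j) (y ^ j))
  where
  lemma : ∀ C X S Y → C * X * (S * Y) ≡ C * S * X * Y
  lemma = solve-∀

module _ (a b p q : ℤ) where

  W[i+[i+m]]+[-q]^i*W[m]≡V[i]*W[i+m] : ∀ i m →
    W a b p q (i +ℕ (i +ℕ m)) + (- q) ^ i * W a b p q m ≡ V p q i * W a b p q (i +ℕ m)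
  W[i+[i+m]]+[-q]^i*W[m]≡V[i]*W[i+m] = ℕ-induction₂ Identity
    (λ m → identity-at-0 (W' m))
    (λ m → identity-at-1 p q (W' (suc m)) (W' m))
    step
    where
    W' : ℕ → ℤ
    W' = W a b p q

    Identity : ℕ → Set
    Identity i = ∀ m → W' (i +ℕ (i +ℕ m)) + (- q) ^ i * W' m ≡ V p q i * W' (i +ℕ m)

    identity-at-0 : ∀ X → X + + 1 * X ≡ + 2 * X
    identity-at-0 = solve-∀

    identity-at-1 : ∀ p q A B → p * A + q * B + (- q * + 1) * B ≡ p * A
    identity-at-1 = solve-∀

    i+[2+m]≡2+[i+m] : ∀ i m → i +ℕ suc (suc m) ≡ suc (suc (i +ℕ m))
    i+[2+m]≡2+[i+m] i m = trans (+-suc i (suc m)) (cong suc (+-suc i m))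

    -- W (m + 2i + 4) = p W (m + 2i + 3) + q W (m + 2i + 2): add p times the identity
    -- for i + 1 at m + 1 to q times the identity for i at m + 2.
    step : ∀ i → Identity i → Identity (suc i) → Identity (suc (suc i))
    step i IH₀ IH₁ m = begin
        p * W' (suc (i +ℕ suc (suc (i +ℕ m)))) + q * W' (i +ℕ suc (suc (i +ℕ m)))
          + (- q * (- q * E)) * W' m
      ≡⟨ cong₂ (λ s t → p * W' s + q * W' t + (- q * (- q * E)) * W' m)
               (cong (λ t → suc (i +ℕ suc t)) (sym (+-suc i m)))
               (cong (i +ℕ_) (sym (i+[2+m]≡2+[i+m] i m))) ⟩
        p * W' (suc i +ℕ (suc i +ℕ suc m)) + q * W' (i +ℕ (i +ℕ suc (suc m)))
          + (- q * (- q * E)) * W' m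
      ≡⟨ regroup p q E (W' (suc i +ℕ (suc i +ℕ suc m))) (W' (i +ℕ (i +ℕ suc (suc m))))
                       (W' (suc m)) (W' m) ⟩
        p * (W' (suc i +ℕ (suc i +ℕ suc m)) + (- q * E) * W' (suc m))
          + q * (W' (i +ℕ (i +ℕ suc (suc m))) + E * W' (suc (suc m)))
      ≡⟨ cong₂ (λ s t → p * s + q * t) (IH₁ (suc m)) (IH₀ (suc (suc m))) ⟩
        p * (V p q (suc i) * W' (suc (i +ℕ suc m))) + q * (V p q i * W' (i +ℕ suc (suc m)))
      ≡⟨ cong₂ (λ s t → p * (V p q (suc i) * W' s) + q * (V p q i * W' t))
               (cong suc (+-suc i m)) (i+[2+m]≡2+[i+m] i m) ⟩
        p * (V p q (suc i) * W' (suc (suc (i +ℕ m))))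
          + q * (V p q i * W' (suc (suc (i +ℕ m))))
      ≡⟨ factor p q (V p q (suc i)) (V p q i) (W' (suc (suc (i +ℕ m)))) ⟩
        V p q (suc (suc i)) * W' (suc (suc i) +ℕ m)
      ∎
      where
      E = (- q) ^ i
      regroup : ∀ p q E A B W₁ W₀ → p * A + q * B + (- q * (- q * E)) * W₀
                                   ≡ p * (A + (- q * E) * W₁) + q * (B + E * (p * W₁ + q * W₀))
      regroup = solve-∀
      factor : ∀ p q V₁ V₀ X → p * (V₁ * X) + q * (V₀ * X) ≡ (p * V₁ + q * V₀) * X
      factor = solve-∀

  W[k*i]-recurrence : ∀ i y → (- q) ^ i ≡ - y → ∀ k →
    W a b p q (suc (suc k) *ℕ i) ≡ V p q i * W a b p q (suc k *ℕ i) + y * W a b p q (k *ℕ i)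
  W[k*i]-recurrence i y [-q]^i≡-y k = begin
      A
    ≡⟨ lemma A B y ⟩
      A + - y * B + y * B
    ≡⟨ cong (λ e → A + e * B + y * B) (sym [-q]^i≡-y) ⟩
      A + (- q) ^ i * B + y * B
    ≡⟨ cong (_+ y * B) (W[i+[i+m]]+[-q]^i*W[m]≡V[i]*W[i+m] i (k *ℕ i)) ⟩
      V p q i * W a b p q (suc k *ℕ i) + y * B
    ∎
    where
    A = W a b p q (suc (suc k) *ℕ i)
    B = W a b p q (k *ℕ i)
    lemma : ∀ A B y → A ≡ A + - y * B + y * B
    lemma = solve-∀

  W[n*i+i]-expansion : ∀ i y → (- q) ^ i ≡ - y →
    let open FibonacciPolynomial (V p q i) y in
    ∀ n → W a b p q (suc n *ℕ i +ℕ i) ≡ F (suc n) * W a b p q i + y * a * F n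
  W[n*i+i]-expansion i y [-q]^i≡-y n = begin
      W a b p q (suc n *ℕ i +ℕ i)
    ≡⟨ cong (W a b p q) (+-comm (suc n *ℕ i) i) ⟩
      W a b p q (suc (suc n) *ℕ i)
    ≡⟨ recurrence-solution (λ k → W a b p q (k *ℕ i)) (W[k*i]-recurrence i y [-q]^i≡-y) n ⟩
      F (suc n) * W a b p q (i +ℕ 0) + y * a * F n
    ≡⟨ cong (λ k → F (suc n) * W a b p q k + y * a * F n) (+-identityʳ i) ⟩
      F (suc n) * W a b p q i + y * a * F n
    ∎
    where open FibonacciPolynomial (V p q i) y

[-y]*a*s≡-[y*a*s] : ∀ y a s → - y * a * s ≡ - (y * a * s)
[-y]*a*s≡-[y*a*s] = solve-∀

-- 2 ≤ n only excludes n = 0, where (0 ∸ 1) / 2 = 0 turns the second sum into a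
-- spurious q ^ i * a.
theorem4 : (a b p q : ℤ) (i n : ℕ) → 1 ≤ i → 2 ≤ n →
    (Odd i →
      W a b p q (n *ℕ i +ℕ i)
        ≡ sumTo (n / 2) (λ j → + ((n ∸ j) C j) * V p q i ^ (n ∸ 2 *ℕ j) * (q ^ i) ^ j * W a b p q i)
          + q ^ i * a * sumTo ((n ∸ 1) / 2) (λ j → + ((n ∸ j ∸ 1) C j) * V p q i ^ (n ∸ 2 *ℕ j ∸ 1) * (q ^ i) ^ j))
    ×
    (Even i →
      W a b p q (n *ℕ i +ℕ i)
        ≡ sumTo (n / 2) (λ j → + ((n ∸ j) C j) * (- + 1) ^ j * V p q i ^ (n ∸ 2 *ℕ j) * (q ^ i) ^ j * W a b p q i)
          - q ^ i * a * sumTo ((n ∸ 1) / 2) (λ j → + ((n ∸ j ∸ 1) C j) * (- + 1) ^ j * V p q i ^ (n ∸ 2 *ℕ j ∸ 1) * (q ^ i) ^ j))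
theorem4 a b p q i zero    _ ()
theorem4 a b p q i (suc n) _ _ =
  (λ i-odd → let open FibonacciPolynomial x Y in
    trans (W[n*i+i]-expansion a b p q i Y (Odd⇒[-x]^n≡-x^n q i-odd) n)
          (cong₂ _+_ (sym (sumTo-*ʳ (suc n / 2) (term (suc n)) Wᵢ))
                     (cong (Y * a *_) (F≡sumTo-shifted n)))) ,
  (λ i-even → let open FibonacciPolynomial x (- Y) in
    trans (W[n*i+i]-expansion a b p q i (- Y)
             (trans (Even⇒[-x]^n≡x^n q i-even) (sym (neg-involutive Y))) n)
          (cong₂ _+_
            (trans (sym (sumTo-*ʳ (suc n / 2) (term (suc n)) Wᵢ))
                   (sumTo-cong (suc n / 2) λ j →
                     cong (_* Wᵢ) (signed-summand x Y ((suc n ∸ j) C j) (suc n ∸ 2 *ℕ j) j)))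
            (trans ([-y]*a*s≡-[y*a*s] Y a (F n))
                   (cong (λ s → - (Y * a * s))
                     (trans (F≡sumTo-shifted n) (sumTo-cong (n / 2) λ j →
                       signed-summand x Y ((suc n ∸ j ∸ 1) C j) (suc n ∸ 2 *ℕ j ∸ 1) j))))))
  where
  x Y Wᵢ : ℤ
  x  = V p q i
  Y  = q ^ i
  Wᵢ = W a b p q i
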